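{- Let $\lambda\in\mathbb{N}^n$ be a partition. For $\heartsuit\in\{B,C,D\}$ and every element $w$ of the Weyl group of type $\heartsuit$ (generated by $s_1,\dots,s_n$ for $B_n,C_n$, and by $s_1,\dots,s_{n-1},\tau_n$ for $D_n$), every monomial $x^u$ appearing in the expansion of $x^\lambda\pi^\heartsuit_w$ satisfies $u\ge-\lambda$. For every $w\in\mathfrak S_n$ (type $A_{n-1}$), every monomial $x^u$ in $x^\lambda\pi_w$ satisfies $u\ge\lambda\omega=[\lambda_n,\dots,\lambda_1]$.
   Context: Operators written on the right. $s_i$ exchanges $x_i,x_{i+1}$ ($i<n$); $s_n:x_n\mapsto x_n^{ -1}$; $\tau_n:x_{n-1}\mapsto x_n^{ -1},x_n\mapsto x_{n-1}^{ -1}$. $f\pi_i=\frac{x_if-x_{i+1}f^{s_i}}{x_i-x_{i+1}}$; $f\pi_n^C=\frac{x_nf-x_n^{ -1}f^{s_n}}{x_n-x_n^{ -1}}$; $f\pi_n^B=\frac{x_nf-f^{s_n}}{x_n-1}$; $f\pi_n^D=\frac{f-x_{n-1}^{ -1}x_n^{ -1}f^{\tau_n}}{1-x_{n-1}^{ -1}x_n^{ -1}}$. For $w$ with reduced decomposition $w=g_1\cdots g_k$ in the generators, $\pi^\heartsuit_w$ is the product of the corresponding operators (with $\pi^\heartsuit_n$ for $s_n$ or $\tau_n$), well defined by the braid relations. Order on $\mathbb{Z}^n$: $u\le v$ iff $u_1+\dots+u_k\le v_1+\dots+v_k$ for all $k=1,\dots,n$. -}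

module Defs where

open import Data.Nat as ℕ using (ℕ; zero; suc)
open import Data.Integer as ℤ using (ℤ; 0ℤ; 1ℤ; -_; +_)
open import Data.Fin using (Fin; zero; suc; inject₁)
import Data.Fin as Fin
open import Data.Vec as Vec using (Vec; []; _∷_; lookup; toList; replicate; zipWith; tabulate)
open import Data.Vec.Properties using (≡-dec)
open import Data.List as List using (List; []; _∷_; _++_; concatMap; length)
open import Data.Product using (_×_; _,_)
open import Data.Maybe using (Maybe; just; nothing)
open import Relation.Nullary using (yes; no)
open import Relation.Binary.PropositionalEquality using (_≡_)

-- A Laurent monomial x^u is given by its exponent vector u ∈ ℤ^n.
-- A Laurent polynomial is a finite formal sum of terms c·x^u (a list);
-- its coefficient at x^u is the sum of the c's of terms with exponent u.

Exp : ℕ → Set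
Exp n = Vec ℤ n

LPoly : ℕ → Set
LPoly n = List (ℤ × Exp n)

coeff : ∀ {n} → LPoly n → Exp n → ℤ
coeff [] u = 0ℤ
coeff ((c , e) ∷ p) u with ≡-dec ℤ._≟_ e u
... | yes _ = c ℤ.+ coeff p u
... | no _  = coeff p u

_≈_ : ∀ {n} → LPoly n → LPoly n → Set
p ≈ q = ∀ u → coeff p u ≡ coeff q u

_+ᴾ_ : ∀ {n} → LPoly n → LPoly n → LPoly n
p +ᴾ q = p ++ q

-ᴾ_ : ∀ {n} → LPoly n → LPoly n
-ᴾ p = List.map (λ { (c , e) → (- c , e) }) p

_-ᴾ_ : ∀ {n} → LPoly n → LPoly n → LPoly n
p -ᴾ q = p +ᴾ (-ᴾ q)

_*ᴾ_ : ∀ {n} → LPoly n → LPoly n → LPoly n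
p *ᴾ q = concatMap (λ { (c , e) → List.map (λ { (d , e') → (c ℤ.* d , zipWith ℤ._+_ e e') }) q }) p

mono : ∀ {n} → Exp n → LPoly n
mono u = (1ℤ , u) ∷ []

one : ∀ {n} → LPoly n
one = mono (replicate _ 0ℤ)

xpow : ∀ {n} → Fin n → ℤ → LPoly n
xpow {n} i k = mono (tabulate (λ j → if-eq j))
  where
  if-eq : Fin n → ℤ
  if-eq j with i Fin.≟ j
  ... | yes _ = k
  ... | no _  = 0ℤ

-- the variable x_i (0-indexed Fin) and its inverse
var : ∀ {n} → Fin n → LPoly n
var i = xpow i 1ℤ

varInv : ∀ {n} → Fin n → LPoly n
varInv i = xpow i (- 1ℤ)

subst : ∀ {n} → (Exp n → Exp n) → LPoly n → LPoly n
subst σ p = List.map (λ { (c , e) → (c , σ e) }) p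

-- Generators, acting on exponent vectors (n = suc m variables).
-- Fin m indexes s_1..s_{n-1}: s_{i+1} exchanges x_{i+1}, x_{i+2}
-- (0-indexed positions inject₁ i and suc i).

swapAt : ∀ {A : Set} {m} → Fin m → Vec A (suc m) → Vec A (suc m)
swapAt {m = suc m} zero (a ∷ b ∷ v) = b ∷ a ∷ v
swapAt {m = suc m} (suc i) (a ∷ v) = a ∷ swapAt i v

negLast : ∀ {n} → Exp n → Exp n
negLast [] = []
negLast (a ∷ []) = (- a) ∷ []
negLast (a ∷ b ∷ v) = a ∷ negLast (b ∷ v)

-- τ_n : x_{n-1} ↦ x_n^{-1}, x_n ↦ x_{n-1}^{-1}
-- on exponents: (…, a, b) ↦ (…, -b, -a)   (identity if n < 2; unused then)
tauLast : ∀ {n} → Exp n → Exp n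
tauLast [] = []
tauLast (a ∷ []) = a ∷ []
tauLast (a ∷ b ∷ []) = (- b) ∷ (- a) ∷ []
tauLast (a ∷ b ∷ c ∷ v) = a ∷ tauLast (b ∷ c ∷ v)

data Heart : Set where
  B C D : Heart

actA : ∀ {m} → Fin m → Exp (suc m) → Exp (suc m)
actA i = swapAt i

-- type B/C/D generators: just i = s_{i+1}, nothing = s_n (B,C) or τ_n (D)
actBCD : ∀ {m} → Heart → Maybe (Fin m) → Exp (suc m) → Exp (suc m)
actBCD t (just i) = swapAt i
actBCD B nothing = negLast
actBCD C nothing = negLast
actBCD D nothing = tauLast

-- action of a word g_1 ⋯ g_k (operators on the right: g_1 first)
actWord : ∀ {G : Set} {n} → (G → Exp n → Exp n) → List G → Exp n → Exp n
actWord act [] v = v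
actWord act (g ∷ w) v = actWord act w (act g v)

-- a word is reduced if no word representing the same Weyl group element
-- (same action on ℤ^n, which is faithful) is shorter
Reduced : ∀ {G : Set} {n} → (G → Exp n → Exp n) → List G → Set
Reduced {G} act w = ∀ (w' : List G) → (∀ v → actWord act w' v ≡ actWord act w v)
                    → length w ℕ.≤ length w'

-- Divided difference operators, as relations:  PiX g f h  means  h = f π_g,
-- i.e. h is the (unique, since ℤ[x^{±1}] is a domain) quotient of the
-- defining fraction.

PiA : ∀ {m} → Fin m → LPoly (suc m) → LPoly (suc m) → Set
PiA i f h =
  ((var (inject₁ i) -ᴾ var (suc i)) *ᴾ h)
    ≈ ((var (inject₁ i) *ᴾ f) -ᴾ (var (suc i) *ᴾ subst (swapAt i) f))

lastIx : ∀ {m} → Fin (suc m)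
lastIx {m} = Fin.fromℕ m

-- index of x_{n-1} (n = suc m; only meaningful when m ≥ 1)
prevIx : ∀ {m} → Fin (suc m)
prevIx {zero} = zero
prevIx {suc k} = inject₁ (Fin.fromℕ k)

PiBCD : ∀ {m} → Heart → Maybe (Fin m) → LPoly (suc m) → LPoly (suc m) → Set
PiBCD t (just i) f h = PiA i f h
PiBCD {m} C nothing f h =
  ((var lastIx -ᴾ varInv lastIx) *ᴾ h)
    ≈ ((var lastIx *ᴾ f) -ᴾ (varInv lastIx *ᴾ subst negLast f))
PiBCD {m} B nothing f h =
  ((var lastIx -ᴾ one) *ᴾ h)
    ≈ ((var lastIx *ᴾ f) -ᴾ subst negLast f)
PiBCD {m} D nothing f h =
  ((one -ᴾ (varInv prevIx *ᴾ varInv lastIx)) *ᴾ h)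
    ≈ (f -ᴾ ((varInv prevIx *ᴾ varInv lastIx) *ᴾ subst tauLast f))

-- Chain Pi w f h  means  h = f π_{g_1} π_{g_2} ⋯ π_{g_k}  for w = g_1 ⋯ g_k
data Chain {G : Set} {n} (Pi : G → LPoly n → LPoly n → Set)
     : List G → LPoly n → LPoly n → Set where
  done : ∀ {f} → Chain Pi [] f f
  step : ∀ {g w f h k} → Pi g f h → Chain Pi w h k → Chain Pi (g ∷ w) f k

IsPartition : ∀ {n} → Vec ℕ n → Set
IsPartition {n} lam = ∀ (i j : Fin n) → i Fin.≤ j → lookup lam j ℕ.≤ lookup lam i

psum : ∀ {n} → ℕ → Exp n → ℤ
psum k u = List.foldr ℤ._+_ 0ℤ (List.take k (toList u))

_≤D_ : ∀ {n} → Exp n → Exp n → Set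
_≤D_ {n} u v = ∀ k → 1 ℕ.≤ k → k ℕ.≤ n → psum k u ℤ.≤ psum k v

toExp : ∀ {n} → Vec ℕ n → Exp n
toExp = Vec.map +_

negExp : ∀ {n} → Vec ℕ n → Exp n
negExp = Vec.map (λ a → - (+ a))

{-# OPTIONS --safe #-}
-- If h = f π for the divided difference π of a reflection s with root α, comparing
-- coefficients in (x^a - x^b) h = x^a f - x^b f^s (α = a - b) shows that every monomial
-- of h lies on an α-string between two monomials of f or of f^s. Hence any region that
-- is convex along such strings, invariant under s and contains the support of f also
-- contains that of h; by induction on the word, the support of x^λ π_w stays in any
-- Weyl-invariant convex region containing λ. For types B, C, D take
-- {u | σ · u ≤ λ₁ + ⋯ + λ_k for every σ ∈ {-1,0,1}^n with k nonzero entries}, for type A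
-- {u | σ · u ≤ -(λ_n + ⋯ + λ_{n-k+1}) for every σ ∈ {0,-1}^n with k nonzero entries};
-- σ = (-1,…,-1,0,…,0) then gives the two dominance bounds.

module Submission where

open import Defs
open import Data.Empty using (⊥-elim)
open import Data.Fin as Fin using (Fin; zero; suc; inject₁)
import Data.Fin.Properties as Finₚ
open import Data.Integer as ℤ using (ℤ; 0ℤ; 1ℤ; -_; +_; _+_; _*_; _-_; _≤_; _<_; ∣_∣; _⊔_)
import Data.Integer.Properties as ℤ
open import Algebra.Properties.CommutativeSemigroup ℤ.+-commutativeSemigroup
  using () renaming (x∙yz≈y∙xz to i+[j+k]≡j+[i+k])
open import Data.Integer.Tactic.RingSolver using (solve-∀)
open import Data.List as List using (List; []; _∷_; _++_)
open import Data.Maybe using (Maybe; just; nothing)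
open import Data.Nat as ℕ using (ℕ; zero; suc; z≤n; s≤s)
import Data.Nat.Properties as ℕ
open import Algebra.Properties.CommutativeSemigroup ℕ.+-commutativeSemigroup
  using () renaming (x∙yz≈y∙xz to m+[n+o]≡n+[m+o])
open import Data.Nat.GeneralisedArithmetic using (iterate)
open import Data.Product using (_×_; _,_; ∃)
open import Data.Sum using (_⊎_; inj₁; inj₂)
open import Data.Vec as Vec using (Vec; []; _∷_; lookup; replicate; zipWith; tabulate; reverse; _∷ʳ_)
import Data.Vec.Properties as Vec
open import Data.Vec.Properties using (≡-dec)
open import Data.Vec.Relation.Unary.All as All using (All; []; _∷_)
import Data.Vec.Relation.Unary.All.Properties as All
open import Function using (_∘_)
open import Level using (0ℓ)
open import Relation.Nullary using (yes; no)
open import Relation.Unary using (Pred; _⊆_; _∪_; _⊢_; _∈_)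
open import Relation.Binary.PropositionalEquality hiding (subst)
import Relation.Binary.PropositionalEquality as ≡

infixl 6 _⊕_ _⊖_

_⊕_ : ∀ {n} → Exp n → Exp n → Exp n
u ⊕ v = zipWith _+_ u v

_⊖_ : ∀ {n} → Exp n → Exp n → Exp n
u ⊖ v = zipWith _-_ u v

⊕-comm : ∀ {n} (u v : Exp n) → u ⊕ v ≡ v ⊕ u
⊕-comm = Vec.zipWith-comm ℤ.+-comm

⊕-⊖-cancelʳ : ∀ {n} (u v : Exp n) → u ⊕ v ⊖ v ≡ u
⊕-⊖-cancelʳ [] [] = refl
⊕-⊖-cancelʳ (x ∷ u) (y ∷ v) = cong₂ _∷_ (x+y-y≡x x y) (⊕-⊖-cancelʳ u v)
  where
  x+y-y≡x : ∀ x y → x + y - y ≡ x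
  x+y-y≡x = solve-∀

⊖-⊕-cancelʳ : ∀ {n} (u v : Exp n) → u ⊖ v ⊕ v ≡ u
⊖-⊕-cancelʳ [] [] = refl
⊖-⊕-cancelʳ (x ∷ u) (y ∷ v) = cong₂ _∷_ (x-y+y≡x x y) (⊖-⊕-cancelʳ u v)
  where
  x-y+y≡x : ∀ x y → x - y + y ≡ x
  x-y+y≡x = solve-∀

⊕-⊖-assoc : ∀ {n} (u v w : Exp n) → u ⊕ v ⊖ w ≡ u ⊕ (v ⊖ w)
⊕-⊖-assoc [] [] [] = refl
⊕-⊖-assoc (x ∷ u) (y ∷ v) (z ∷ w) = cong₂ _∷_ (x+y-z≡x+[y-z] x y z) (⊕-⊖-assoc u v w)
  where
  x+y-z≡x+[y-z] : ∀ x y z → x + y - z ≡ x + (y - z)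
  x+y-z≡x+[y-z] = solve-∀

⊖-identityʳ : ∀ {n} (u : Exp n) → u ⊖ replicate n 0ℤ ≡ u
⊖-identityʳ = Vec.zipWith-identityʳ ℤ.+-identityʳ

supp : ∀ {n} → LPoly n → Pred (Exp n) 0ℓ
supp p u = coeff p u ≢ 0ℤ

supp-mono : ∀ {n} {e : Exp n} {P : Pred (Exp n) 0ℓ} → P e → supp (mono e) ⊆ P
supp-mono {e = e} Pe {u} u∈supp with ≡-dec ℤ._≟_ e u
... | yes refl = Pe
... | no _     = ⊥-elim (u∈supp refl)

coeff-++ : ∀ {n} (p q : LPoly n) u → coeff (p ++ q) u ≡ coeff p u + coeff q u
coeff-++ [] q u = sym (ℤ.+-identityˡ _)
coeff-++ ((c , e) ∷ p) q u with ≡-dec ℤ._≟_ e u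
... | yes _ = trans (cong (_+_ c) (coeff-++ p q u)) (sym (ℤ.+-assoc c _ _))
... | no _  = coeff-++ p q u

-- g is kept abstract so that the pattern lambdas of -ᴾ, subst and *ᴾ instantiate it by refl.
coeff-map : ∀ {n} (κ : ℤ → ℤ) (φ ψ : Exp n → Exp n) (g : ℤ × Exp n → ℤ × Exp n)
  → (∀ x y → κ (x + y) ≡ κ x + κ y) → κ 0ℤ ≡ 0ℤ
  → (∀ e → ψ (φ e) ≡ e) → (∀ u → φ (ψ u) ≡ u)
  → (∀ c e → g (c , e) ≡ (κ c , φ e))
  → ∀ p u → coeff (List.map g p) u ≡ κ (coeff p (ψ u))
coeff-map κ φ ψ g κ-+ κ-0 ψ∘φ φ∘ψ g-def [] u = sym κ-0
coeff-map κ φ ψ g κ-+ κ-0 ψ∘φ φ∘ψ g-def ((c , e) ∷ p) u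
  rewrite g-def c e with ≡-dec ℤ._≟_ (φ e) u | ≡-dec ℤ._≟_ e (ψ u)
... | yes _ | yes _ =
  trans (cong (_+_ (κ c)) (coeff-map κ φ ψ g κ-+ κ-0 ψ∘φ φ∘ψ g-def p u)) (sym (κ-+ c _))
... | no _ | no _ = coeff-map κ φ ψ g κ-+ κ-0 ψ∘φ φ∘ψ g-def p u
... | yes φe≡u | no e≢ψu = ⊥-elim (e≢ψu (trans (sym (ψ∘φ e)) (cong ψ φe≡u)))
... | no φe≢u | yes e≡ψu = ⊥-elim (φe≢u (trans (cong φ e≡ψu) (φ∘ψ u)))

coeff-neg : ∀ {n} (p : LPoly n) u → coeff (-ᴾ p) u ≡ - coeff p u
coeff-neg = coeff-map -_ (λ e → e) (λ e → e) _ ℤ.neg-distrib-+ refl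
                      (λ _ → refl) (λ _ → refl) (λ _ _ → refl)

coeff-subst : ∀ {n} {s : Exp n → Exp n} → (∀ u → s (s u) ≡ u)
  → ∀ f u → coeff (subst s f) u ≡ coeff f (s u)
coeff-subst {s = s} s-inv =
  coeff-map (λ c → c) s s _ (λ _ _ → refl) refl s-inv s-inv (λ _ _ → refl)

coeff-minus : ∀ {n} (p q : LPoly n) u → coeff (p -ᴾ q) u ≡ coeff p u - coeff q u
coeff-minus p q u = trans (coeff-++ p (-ᴾ q) u) (cong (_+_ (coeff p u)) (coeff-neg q u))

coeff-*ᴾ-∷ : ∀ {n} c (e : Exp n) p q u
  → coeff (((c , e) ∷ p) *ᴾ q) u ≡ c * coeff q (u ⊖ e) + coeff (p *ᴾ q) u
coeff-*ᴾ-∷ c e p q u = trans (coeff-++ (List.map _ q) (p *ᴾ q) u)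
  (cong (_+ coeff (p *ᴾ q) u)
        (coeff-map (c *_) (e ⊕_) (_⊖ e) _ (ℤ.*-distribˡ-+ c) (ℤ.*-zeroʳ c)
                   (λ e′ → trans (cong (_⊖ e) (⊕-comm e e′)) (⊕-⊖-cancelʳ e′ e))
                   (λ u → trans (⊕-comm e (u ⊖ e)) (⊖-⊕-cancelʳ u e))
                   (λ _ _ → refl) q u))

coeff-mono-*ᴾ : ∀ {n} (e : Exp n) q u → coeff (mono e *ᴾ q) u ≡ coeff q (u ⊖ e)
coeff-mono-*ᴾ e q u =
  trans (coeff-*ᴾ-∷ 1ℤ e [] q u) (trans (ℤ.+-identityʳ _) (ℤ.*-identityˡ _))

coeff-binomial-*ᴾ : ∀ {n} (a b : Exp n) q u
  → coeff ((mono a -ᴾ mono b) *ᴾ q) u ≡ coeff q (u ⊖ a) - coeff q (u ⊖ b)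
coeff-binomial-*ᴾ a b q u = begin
  coeff ((mono a -ᴾ mono b) *ᴾ q) u     ≡⟨ coeff-*ᴾ-∷ 1ℤ a (-ᴾ mono b) q u ⟩
  1ℤ * qa + coeff ((-ᴾ mono b) *ᴾ q) u  ≡⟨ cong (_+_ (1ℤ * qa)) (coeff-*ᴾ-∷ (- 1ℤ) b [] q u) ⟩
  1ℤ * qa + (- 1ℤ * qb + 0ℤ)            ≡⟨ binomial qa qb ⟩
  qa - qb                               ∎
  where
  open ≡-Reasoning
  qa = coeff q (u ⊖ a)
  qb = coeff q (u ⊖ b)
  binomial : ∀ x y → 1ℤ * x + (- 1ℤ * y + 0ℤ) ≡ x - y
  binomial = solve-∀

*ᴾ-identityˡ : ∀ {n} (p : LPoly n) → (one *ᴾ p) ≈ p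
*ᴾ-identityˡ p u = trans (coeff-mono-*ᴾ _ p u) (cong (coeff p) (⊖-identityʳ u))

-ᴾ-cong : ∀ {n} {p p′ q q′ : LPoly n} → p ≈ p′ → q ≈ q′ → (p -ᴾ q) ≈ (p′ -ᴾ q′)
-ᴾ-cong {p = p} {p′} {q} {q′} p≈p′ q≈q′ u =
  trans (coeff-minus p q u) (trans (cong₂ _-_ (p≈p′ u) (q≈q′ u)) (sym (coeff-minus p′ q′ u)))

IsDividedDifference : ∀ {n} → (Exp n → Exp n) → Exp n → Exp n → LPoly n → LPoly n → Set
IsDividedDifference s a b f h = ((mono a -ᴾ mono b) *ᴾ h) ≈ ((mono a *ᴾ f) -ᴾ (mono b *ᴾ subst s f))

IsDividedDifference⇒string : ∀ {n} {s : Exp n → Exp n} {a b f h} → (∀ u → s (s u) ≡ u)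
  → IsDividedDifference s a b f h
  → ∀ v → coeff h v - coeff h (v ⊕ (a ⊖ b)) ≡ coeff f v - coeff f (s (v ⊕ (a ⊖ b)))
IsDividedDifference⇒string {s = s} {a} {b} {f} {h} s-inv dd v = begin
  coeff h v - coeff h (v ⊕ (a ⊖ b))
    ≡⟨ sym (cong₂ _-_ (cong (coeff h) (⊕-⊖-cancelʳ v a)) (cong (coeff h) (⊕-⊖-assoc v a b))) ⟩
  coeff h (u ⊖ a) - coeff h (u ⊖ b)                  ≡⟨ sym (coeff-binomial-*ᴾ a b h u) ⟩
  coeff ((mono a -ᴾ mono b) *ᴾ h) u                  ≡⟨ dd u ⟩
  coeff ((mono a *ᴾ f) -ᴾ (mono b *ᴾ subst s f)) u
    ≡⟨ coeff-minus (mono a *ᴾ f) (mono b *ᴾ subst s f) u ⟩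
  coeff (mono a *ᴾ f) u - coeff (mono b *ᴾ subst s f) u
    ≡⟨ cong₂ _-_ (coeff-mono-*ᴾ a f u)
                 (trans (coeff-mono-*ᴾ b (subst s f) u) (coeff-subst s-inv f (u ⊖ b))) ⟩
  coeff f (u ⊖ a) - coeff f (s (u ⊖ b))
    ≡⟨ cong₂ _-_ (cong (coeff f) (⊕-⊖-cancelʳ v a)) (cong (coeff f ∘ s) (⊕-⊖-assoc v a b)) ⟩
  coeff f v - coeff f (s (v ⊕ (a ⊖ b)))                      ∎
  where
  open ≡-Reasoning
  u = v ⊕ a

record DividedDifference {n} (s : Exp n → Exp n) (f h : LPoly n) : Set where
  field
    a b      : Exp n
    j        : Fin n
    positive : 1ℤ ≤ lookup a j - lookup b j
    relation : IsDividedDifference s a b f h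

  root : Exp n
  root = a ⊖ b

i≤+∣i∣ : ∀ i → i ≤ + ∣ i ∣
i≤+∣i∣ (+ _)      = ℤ.≤-refl
i≤+∣i∣ ℤ.-[1+ _ ] = ℤ.-≤+

<-+-positive : ∀ i {d} → 1ℤ ≤ d → i < i + d
<-+-positive i {d} 1≤d = ℤ.suc[i]≤j⇒i<j (≡.subst (_≤ i + d) (ℤ.+-comm i 1ℤ) (ℤ.+-monoʳ-≤ i 1≤d))

maxOver : ∀ {n} → (Exp n → ℤ) → LPoly n → ℤ
maxOver φ []            = 0ℤ
maxOver φ ((_ , e) ∷ p) = φ e ⊔ maxOver φ p

supp⇒≤maxOver : ∀ {n} (φ : Exp n → ℤ) p {u} → u ∈ supp p → φ u ≤ maxOver φ p
supp⇒≤maxOver φ [] u∈supp = ⊥-elim (u∈supp refl)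
supp⇒≤maxOver φ ((c , e) ∷ p) {u} u∈supp with ≡-dec ℤ._≟_ e u
... | yes refl = ℤ.i≤i⊔j _ _
... | no _     = ℤ.i≤j⇒i≤k⊔j _ (supp⇒≤maxOver φ p u∈supp)

-- A walk through Q that climbs in a height bounded on Q must leave Q, and it can only do so
-- through P.
module _ {n} {Q P : Pred (Exp n) 0ℓ} (next : Exp n → Exp n) (height : Exp n → ℤ) (M : ℤ)
         (climbs : ∀ v → height v < height (next v))
         (bounded : ∀ {v} → v ∈ Q → height v ≤ M)
         (progress : ∀ {v} → v ∈ Q → v ∈ P ⊎ next v ∈ P ⊎ next v ∈ Q) where

  private
    walk-with-fuel : ∀ N v → M < height v + + N → v ∈ Q → ∃ λ k → iterate next v k ∈ P
    walk-with-fuel zero v M<h v∈Q =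
      ⊥-elim (ℤ.<⇒≱ (≡.subst (M <_) (ℤ.+-identityʳ _) M<h) (bounded v∈Q))
    walk-with-fuel (suc N) v M<h+1+N v∈Q with progress v∈Q
    ... | inj₁ v∈P          = 0 , v∈P
    ... | inj₂ (inj₁ v′∈P) = 1 , v′∈P
    ... | inj₂ (inj₂ v′∈Q) with walk-with-fuel N (next v) M<h′+N v′∈Q
      where
      open ℤ.≤-Reasoning
      h+[1+N]≡[1+h]+N : ∀ h N → h + (1ℤ + N) ≡ (1ℤ + h) + N
      h+[1+N]≡[1+h]+N = solve-∀
      M<h′+N : M < height (next v) + + N
      M<h′+N = begin-strict
        M                        <⟨ M<h+1+N ⟩
        height v + (1ℤ + + N)    ≡⟨ h+[1+N]≡[1+h]+N (height v) (+ N) ⟩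
        ℤ.suc (height v) + + N   ≤⟨ ℤ.+-monoˡ-≤ (+ N) (ℤ.i<j⇒suc[i]≤j (climbs v)) ⟩
        height (next v) + + N    ∎
    ... | k , p = suc k , p

  walk-reaches : ∀ {v} → v ∈ Q → ∃ λ k → iterate next v k ∈ P
  walk-reaches {v} = walk-with-fuel (suc ∣ M - height v ∣) v enough
    where
    open ℤ.≤-Reasoning
    M≡h+[M-h] : ∀ M h → M ≡ h + (M - h)
    M≡h+[M-h] = solve-∀
    enough : M < height v + + suc ∣ M - height v ∣
    enough = begin-strict
      M                                  ≡⟨ M≡h+[M-h] M (height v) ⟩
      height v + (M - height v)          ≤⟨ ℤ.+-monoʳ-≤ (height v) (i≤+∣i∣ _) ⟩
      height v + + ∣ M - height v ∣      <⟨ ℤ.+-monoʳ-< (height v) (ℤ.+<+ (ℕ.n<1+n _)) ⟩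
      height v + + suc ∣ M - height v ∣  ∎

module _ {n} {s : Exp n → Exp n} (s-inv : ∀ u → s (s u) ≡ u) {f h : LPoly n}
         (Δ : DividedDifference s f h) where
  open DividedDifference Δ

  private
    α = root
    Mirrored = supp f ∪ (s ⊢ supp f)

    constant-along-string : ∀ {v} → coeff f v ≡ 0ℤ → coeff f (s (v ⊕ α)) ≡ 0ℤ
      → coeff h v ≡ coeff h (v ⊕ α)
    constant-along-string {v} f-v f-sv = ℤ.i-j≡0⇒i≡j (coeff h v) (coeff h (v ⊕ α)) (begin
      coeff h v - coeff h (v ⊕ α)
        ≡⟨ IsDividedDifference⇒string {a = a} {b} {f} {h} s-inv relation v ⟩
      coeff f v - coeff f (s (v ⊕ α))
        ≡⟨ cong₂ _-_ f-v f-sv ⟩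
      0ℤ
        ∎)
      where open ≡-Reasoning

    d = lookup a j - lookup b j

    lookup-⊕α : ∀ v → lookup (v ⊕ α) j ≡ lookup v j + d
    lookup-⊕α v = trans (Vec.lookup-zipWith _+_ j v α)
                        (cong (_+_ (lookup v j)) (Vec.lookup-zipWith _-_ j a b))

    lookup-⊖α : ∀ v → lookup (v ⊖ α) j ≡ lookup v j - d
    lookup-⊖α v = trans (Vec.lookup-zipWith _-_ j v α)
                        (cong (_-_ (lookup v j)) (Vec.lookup-zipWith _-_ j a b))

    ascend : ∀ {v} → v ∈ supp h → ∃ λ k → iterate (_⊕ α) v k ∈ Mirrored
    ascend = walk-reaches {Q = supp h} (_⊕ α) (λ v → lookup v j) (maxOver (λ v → lookup v j) h)
                  climbs (supp⇒≤maxOver _ h) progress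
      where
      climbs : ∀ v → lookup v j < lookup (v ⊕ α) j
      climbs v = ≡.subst (lookup v j <_) (sym (lookup-⊕α v)) (<-+-positive (lookup v j) positive)

      progress : ∀ {v} → v ∈ supp h → v ∈ Mirrored ⊎ v ⊕ α ∈ Mirrored ⊎ v ⊕ α ∈ supp h
      progress {v} h-v with coeff f v ℤ.≟ 0ℤ | coeff f (s (v ⊕ α)) ℤ.≟ 0ℤ
      ... | no f-v  | _        = inj₁ (inj₁ f-v)
      ... | yes _   | no f-sv  = inj₂ (inj₁ (inj₂ f-sv))
      ... | yes f-v | yes f-sv = inj₂ (inj₂ (h-v ∘ trans (constant-along-string f-v f-sv)))

    descend : ∀ {v} → v ∈ supp h → ∃ λ k → iterate (_⊖ α) v k ∈ Mirrored
    descend = walk-reaches {Q = supp h} (_⊖ α) (λ v → - lookup v j) (maxOver (λ v → - lookup v j) h)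
                   climbs (supp⇒≤maxOver _ h) progress
      where
      -[x-d]≡-x+d : ∀ x d → - (x - d) ≡ - x + d
      -[x-d]≡-x+d = solve-∀
      climbs : ∀ v → - lookup v j < - lookup (v ⊖ α) j
      climbs v = ≡.subst (- lookup v j <_)
                         (sym (trans (cong -_ (lookup-⊖α v)) (-[x-d]≡-x+d (lookup v j) d)))
                         (<-+-positive (- lookup v j) positive)

      progress : ∀ {v} → v ∈ supp h → v ∈ Mirrored ⊎ v ⊖ α ∈ Mirrored ⊎ v ⊖ α ∈ supp h
      progress {v} h-v with coeff f (s v) ℤ.≟ 0ℤ | coeff f (v ⊖ α) ℤ.≟ 0ℤ
      ... | no f-sv | _       = inj₁ (inj₂ f-sv)
      ... | yes _   | no f-w  = inj₂ (inj₁ (inj₁ f-w))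
      ... | yes f-sv | yes f-w = inj₂ (inj₂ (h-v ∘ trans (sym h-w≡h-v)))
        where
        h-w≡h-v : coeff h (v ⊖ α) ≡ coeff h v
        h-w≡h-v = begin
          coeff h (v ⊖ α)      ≡⟨ constant-along-string f-w f-s[w+α] ⟩
          coeff h (v ⊖ α ⊕ α)  ≡⟨ cong (coeff h) (⊖-⊕-cancelʳ v α) ⟩
          coeff h v            ∎
          where
          open ≡-Reasoning
          f-s[w+α] : coeff f (s (v ⊖ α ⊕ α)) ≡ 0ℤ
          f-s[w+α] = ≡.subst (λ x → coeff f (s x) ≡ 0ℤ) (sym (⊖-⊕-cancelʳ v α)) f-sv

  π-preserves : ∀ {G : Pred (Exp n) 0ℓ} → (∀ {u} → G u → G (s u))
    → (∀ {v} k l → iterate (_⊕ root) v k ∈ G → iterate (_⊖ root) v l ∈ G → v ∈ G)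
    → supp f ⊆ G → supp h ⊆ G
  π-preserves {G} G-s G-convex f⊆G h-v with ascend h-v | descend h-v
  ... | k , up | l , down = G-convex k l (Mirrored⊆G up) (Mirrored⊆G down)
    where
    Mirrored⊆G : Mirrored ⊆ G
    Mirrored⊆G (inj₁ f-u)  = f⊆G f-u
    Mirrored⊆G (inj₂ f-su) = ≡.subst G (s-inv _) (G-s (f⊆G f-su))

dot : ∀ {n} → Exp n → Exp n → ℤ
dot []      []      = 0ℤ
dot (c ∷ σ) (x ∷ u) = c * x + dot σ u

norm₁ : ∀ {n} → Exp n → ℕ
norm₁ σ = Vec.sum (Vec.map ∣_∣ σ)

dot-⊕ : ∀ {n} (σ u v : Exp n) → dot σ (u ⊕ v) ≡ dot σ u + dot σ v
dot-⊕ []      []      []      = refl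
dot-⊕ (c ∷ σ) (x ∷ u) (y ∷ v) = trans (cong (_+_ (c * (x + y))) (dot-⊕ σ u v)) (distrib c x y _ _)
  where
  distrib : ∀ c x y p q → c * (x + y) + (p + q) ≡ (c * x + p) + (c * y + q)
  distrib = solve-∀

dot-⊖ : ∀ {n} (σ u v : Exp n) → dot σ (u ⊖ v) ≡ dot σ u - dot σ v
dot-⊖ []      []      []      = refl
dot-⊖ (c ∷ σ) (x ∷ u) (y ∷ v) = trans (cong (_+_ (c * (x - y))) (dot-⊖ σ u v)) (distrib c x y _ _)
  where
  distrib : ∀ c x y p q → c * (x - y) + (p - q) ≡ (c * x + p) - (c * y + q)
  distrib = solve-∀

-- For σ ∈ {-1,0,1}^n, norm₁ σ is the number of nonzero entries of σ.
Bounded : ∀ {n} → (ℤ → Set) → (ℕ → ℤ) → Pred (Exp n) 0ℓ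
Bounded T κ u = ∀ σ → All T σ → dot σ u ≤ κ (norm₁ σ)

≤-iterate : ∀ {A : Set} (φ : A → ℤ) (next : A → A) → (∀ x → φ x ≤ φ (next x))
  → ∀ x k → φ x ≤ φ (iterate next x k)
≤-iterate φ next φ-next x zero    = ℤ.≤-refl
≤-iterate φ next φ-next x (suc k) = ℤ.≤-trans (φ-next x) (≤-iterate φ next φ-next (next x) k)

Bounded-convex : ∀ {n T κ} (α : Exp n) {v} k l
  → iterate (_⊕ α) v k ∈ Bounded T κ → iterate (_⊖ α) v l ∈ Bounded T κ → v ∈ Bounded T κ
Bounded-convex α {v} k l up down σ σ∈T with ℤ.≤-total 0ℤ (dot σ α)
... | inj₁ 0≤σα = ℤ.≤-trans (≤-iterate (dot σ) (_⊕ α) grows v k) (up σ σ∈T)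
  where
  grows : ∀ w → dot σ w ≤ dot σ (w ⊕ α)
  grows w = ≡.subst (dot σ w ≤_) (sym (dot-⊕ σ w α)) (ℤ.i≤i+j _ _ {{ℤ.nonNegative 0≤σα}})
... | inj₂ σα≤0 = ℤ.≤-trans (≤-iterate (dot σ) (_⊖ α) grows v l) (down σ σ∈T)
  where
  grows : ∀ w → dot σ w ≤ dot σ (w ⊖ α)
  grows w = ≡.subst (dot σ w ≤_) (sym (dot-⊖ σ w α))
                    (ℤ.i≤i+j _ _ {{ℤ.nonNegative (ℤ.neg-mono-≤ σα≤0)}})

record IsReflection {n} (T : ℤ → Set) (s : Exp n → Exp n) : Set where
  field
    involutive      : ∀ u → s (s u) ≡ u
    dot-adjoint     : ∀ σ u → dot σ (s u) ≡ dot (s σ) u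
    norm₁-invariant : ∀ σ → norm₁ (s σ) ≡ norm₁ σ
    All-invariant   : ∀ {σ} → All T σ → All T (s σ)

  Bounded-invariant : ∀ {κ u} → u ∈ Bounded T κ → s u ∈ Bounded T κ
  Bounded-invariant {κ} {u} u∈B σ σ∈T =
    ≡.subst₂ _≤_ (sym (dot-adjoint σ u)) (cong κ (norm₁-invariant σ))
                 (u∈B (s σ) (All-invariant σ∈T))

π-preserves-Bounded : ∀ {n T κ} {s : Exp n → Exp n} {f h} → IsReflection T s
  → DividedDifference s f h → supp f ⊆ Bounded T κ → supp h ⊆ Bounded T κ
π-preserves-Bounded {T = T} {κ} R Δ =
  π-preserves (IsReflection.involutive R) Δ (IsReflection.Bounded-invariant R {κ})
              (Bounded-convex {T = T} {κ} (DividedDifference.root Δ))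

swapAt-involutive : ∀ {A : Set} {m} (i : Fin m) (v : Vec A (suc m)) → swapAt i (swapAt i v) ≡ v
swapAt-involutive {m = suc m} zero    (a ∷ b ∷ v) = refl
swapAt-involutive {m = suc m} (suc i) (a ∷ v)     = cong (a ∷_) (swapAt-involutive i v)

dot-swapAt : ∀ {m} (i : Fin m) (σ u : Exp (suc m)) → dot σ (swapAt i u) ≡ dot (swapAt i σ) u
dot-swapAt {suc m} zero    (a ∷ b ∷ σ) (x ∷ y ∷ u) = i+[j+k]≡j+[i+k] (a * y) (b * x) (dot σ u)
dot-swapAt {suc m} (suc i) (a ∷ σ)     (x ∷ u)     = cong (_+_ (a * x)) (dot-swapAt i σ u)

norm₁-swapAt : ∀ {m} (i : Fin m) (σ : Exp (suc m)) → norm₁ (swapAt i σ) ≡ norm₁ σ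
norm₁-swapAt {suc m} zero    (a ∷ b ∷ σ) = m+[n+o]≡n+[m+o] ∣ b ∣ ∣ a ∣ (norm₁ σ)
norm₁-swapAt {suc m} (suc i) (a ∷ σ)     = cong (∣ a ∣ ℕ.+_) (norm₁-swapAt i σ)

All-swapAt : ∀ {P : ℤ → Set} {m} (i : Fin m) {σ : Exp (suc m)} → All P σ → All P (swapAt i σ)
All-swapAt {m = suc m} zero    (pa ∷ pb ∷ ps) = pb ∷ pa ∷ ps
All-swapAt {m = suc m} (suc i) (pa ∷ ps)      = pa ∷ All-swapAt i ps

swapAt-isReflection : ∀ {T m} (i : Fin m) → IsReflection T (swapAt i)
swapAt-isReflection i = record
  { involutive      = swapAt-involutive i
  ; dot-adjoint     = dot-swapAt i
  ; norm₁-invariant = norm₁-swapAt i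
  ; All-invariant   = All-swapAt i
  }

negLast-∷ : ∀ {n} a (v : Exp (suc n)) → negLast (a ∷ v) ≡ a ∷ negLast v
negLast-∷ a (b ∷ v) = refl

negLast-involutive : ∀ {n} (v : Exp n) → negLast (negLast v) ≡ v
negLast-involutive []          = refl
negLast-involutive (a ∷ [])    = cong (_∷ []) (ℤ.neg-involutive a)
negLast-involutive (a ∷ b ∷ v) =
  trans (negLast-∷ a (negLast (b ∷ v))) (cong (a ∷_) (negLast-involutive (b ∷ v)))

dot-negLast : ∀ {n} (σ u : Exp n) → dot σ (negLast u) ≡ dot (negLast σ) u
dot-negLast []          []          = refl
dot-negLast (a ∷ [])    (x ∷ [])    =
  cong (_+ 0ℤ) (trans (sym (ℤ.neg-distribʳ-* a x)) (ℤ.neg-distribˡ-* a x))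
dot-negLast (a ∷ b ∷ σ) (x ∷ y ∷ u) = cong (_+_ (a * x)) (dot-negLast (b ∷ σ) (y ∷ u))

norm₁-negLast : ∀ {n} (σ : Exp n) → norm₁ (negLast σ) ≡ norm₁ σ
norm₁-negLast []          = refl
norm₁-negLast (a ∷ [])    = cong (ℕ._+ 0) (ℤ.∣-i∣≡∣i∣ a)
norm₁-negLast (a ∷ b ∷ σ) = cong (∣ a ∣ ℕ.+_) (norm₁-negLast (b ∷ σ))

All-negLast : ∀ {P : ℤ → Set} → (∀ x → P x → P (- x))
  → ∀ {n} {σ : Exp n} → All P σ → All P (negLast σ)
All-negLast P-neg []             = []
All-negLast P-neg (pa ∷ [])      = P-neg _ pa ∷ []
All-negLast P-neg (pa ∷ pb ∷ ps) = pa ∷ All-negLast P-neg (pb ∷ ps)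

negLast-isReflection : ∀ {T n} → (∀ x → T x → T (- x)) → IsReflection T (negLast {n})
negLast-isReflection T-neg = record
  { involutive      = negLast-involutive
  ; dot-adjoint     = dot-negLast
  ; norm₁-invariant = norm₁-negLast
  ; All-invariant   = All-negLast T-neg
  }

tauLast-∷ : ∀ {n} a (v : Exp (suc (suc n))) → tauLast (a ∷ v) ≡ a ∷ tauLast v
tauLast-∷ a (b ∷ c ∷ v) = refl

tauLast-involutive : ∀ {n} (v : Exp n) → tauLast (tauLast v) ≡ v
tauLast-involutive []              = refl
tauLast-involutive (a ∷ [])        = refl
tauLast-involutive (a ∷ b ∷ [])    =
  cong₂ (λ x y → x ∷ y ∷ []) (ℤ.neg-involutive a) (ℤ.neg-involutive b)
tauLast-involutive (a ∷ b ∷ c ∷ v) =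
  trans (tauLast-∷ a (tauLast (b ∷ c ∷ v))) (cong (a ∷_) (tauLast-involutive (b ∷ c ∷ v)))

dot-tauLast : ∀ {n} (σ u : Exp n) → dot σ (tauLast u) ≡ dot (tauLast σ) u
dot-tauLast []              []              = refl
dot-tauLast (a ∷ [])        (x ∷ [])        = refl
dot-tauLast (a ∷ b ∷ [])    (x ∷ y ∷ [])    = swap-neg a b x y
  where
  swap-neg : ∀ a b x y → a * (- y) + (b * (- x) + 0ℤ) ≡ (- b) * x + ((- a) * y + 0ℤ)
  swap-neg = solve-∀
dot-tauLast (a ∷ b ∷ c ∷ σ) (x ∷ y ∷ z ∷ u) =
  cong (_+_ (a * x)) (dot-tauLast (b ∷ c ∷ σ) (y ∷ z ∷ u))

norm₁-tauLast : ∀ {n} (σ : Exp n) → norm₁ (tauLast σ) ≡ norm₁ σ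
norm₁-tauLast []              = refl
norm₁-tauLast (a ∷ [])        = refl
norm₁-tauLast (a ∷ b ∷ [])    rewrite ℤ.∣-i∣≡∣i∣ a | ℤ.∣-i∣≡∣i∣ b =
  m+[n+o]≡n+[m+o] ∣ b ∣ ∣ a ∣ 0
norm₁-tauLast (a ∷ b ∷ c ∷ σ) = cong (∣ a ∣ ℕ.+_) (norm₁-tauLast (b ∷ c ∷ σ))

All-tauLast : ∀ {P : ℤ → Set} → (∀ x → P x → P (- x))
  → ∀ {n} {σ : Exp n} → All P σ → All P (tauLast σ)
All-tauLast P-neg []                  = []
All-tauLast P-neg (pa ∷ [])           = pa ∷ []
All-tauLast P-neg (pa ∷ pb ∷ [])      = P-neg _ pb ∷ P-neg _ pa ∷ []
All-tauLast P-neg (pa ∷ pb ∷ pc ∷ ps) = pa ∷ All-tauLast P-neg (pb ∷ pc ∷ ps)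

tauLast-isReflection : ∀ {T n} → (∀ x → T x → T (- x)) → IsReflection T (tauLast {n})
tauLast-isReflection T-neg = record
  { involutive      = tauLast-involutive
  ; dot-adjoint     = dot-tauLast
  ; norm₁-invariant = norm₁-tauLast
  ; All-invariant   = All-tauLast T-neg
  }

lookup-≡tabulate : ∀ {A : Set} {n} {e : Vec A n} (F : Fin n → A) → e ≡ tabulate F
  → ∀ j → lookup e j ≡ F j
lookup-≡tabulate F refl j = Vec.lookup∘tabulate F j

lookup-≡zipWith : ∀ {A : Set} {n} {f : A → A → A} {xs ys e : Vec A n} → e ≡ zipWith f xs ys
  → ∀ j → lookup e j ≡ f (lookup xs j) (lookup ys j)
lookup-≡zipWith {xs = xs} {ys} refl j = Vec.lookup-zipWith _ j xs ys

-- The exponent vector of xpow i k is built by a helper local to Defs and cannot be named,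
-- so these lemmas speak about any e with xpow i k ≡ mono e, which then holds by refl.
lookup-xpow-at : ∀ {n} (i : Fin n) k {e} → xpow i k ≡ mono e → lookup e i ≡ k
lookup-xpow-at i k {e} refl rewrite lookup-≡tabulate {e = e} _ refl i with i Fin.≟ i
... | yes _  = refl
... | no i≢i = ⊥-elim (i≢i refl)

lookup-xpow-off : ∀ {n} (i : Fin n) k {e j} → i ≢ j → xpow i k ≡ mono e → lookup e j ≡ 0ℤ
lookup-xpow-off i k {e} {j} i≢j refl rewrite lookup-≡tabulate {e = e} _ refl j with i Fin.≟ j
... | yes i≡j = ⊥-elim (i≢j i≡j)
... | no _    = refl

lookup-xpow-*ᴾ-at : ∀ {n} (i i′ : Fin n) k k′ {e} → i ≢ i′ → (xpow i k *ᴾ xpow i′ k′) ≡ mono e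
  → lookup e i′ ≡ 0ℤ + k′
lookup-xpow-*ᴾ-at i i′ k k′ {e} i≢i′ refl =
  trans (lookup-≡zipWith {e = e} refl i′)
        (cong₂ _+_ (lookup-xpow-off i k i≢i′ refl) (lookup-xpow-at i′ k′ refl))

inject₁≢suc : ∀ {m} (i : Fin m) → inject₁ i ≢ suc i
inject₁≢suc (suc i) eq = inject₁≢suc i (Finₚ.suc-injective eq)

module _ {n} {s : Exp n → Exp n} {f h : LPoly n} where
  IsDividedDifference-b≡0 : ∀ {a} → ((mono a -ᴾ one) *ᴾ h) ≈ ((mono a *ᴾ f) -ᴾ subst s f)
    → IsDividedDifference s a (replicate n 0ℤ) f h
  IsDividedDifference-b≡0 {a} π u =
    trans (π u) (-ᴾ-cong {p = mono a *ᴾ f} {mono a *ᴾ f} {subst s f} {one *ᴾ subst s f}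
                         (λ _ → refl) (λ v → sym (*ᴾ-identityˡ (subst s f) v)) u)

  IsDividedDifference-a≡0 : ∀ {b} → ((one -ᴾ mono b) *ᴾ h) ≈ (f -ᴾ (mono b *ᴾ subst s f))
    → IsDividedDifference s (replicate n 0ℤ) b f h
  IsDividedDifference-a≡0 {b} π u =
    trans (π u) (-ᴾ-cong {p = f} {one *ᴾ f} {mono b *ᴾ subst s f} {mono b *ᴾ subst s f}
                         (λ v → sym (*ᴾ-identityˡ f v)) (λ _ → refl) u)

πA-dividedDifference : ∀ {m} {i : Fin m} {f h} → PiA i f h → DividedDifference (swapAt i) f h
πA-dividedDifference {i = i} π = record
  { a = _ ; b = _ ; j = inject₁ i
  ; positive = ≡.subst₂ (λ x y → 1ℤ ≤ x - y)
                 (sym (lookup-xpow-at (inject₁ i) 1ℤ refl))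
                 (sym (lookup-xpow-off (suc i) 1ℤ (inject₁≢suc i ∘ sym) refl)) ℤ.≤-refl
  ; relation = π
  }

πB-dividedDifference : ∀ {m f h} → PiBCD {m} B nothing f h → DividedDifference negLast f h
πB-dividedDifference {m} {f} {h} π = record
  { a = _ ; b = replicate _ 0ℤ ; j = lastIx
  ; positive = ≡.subst₂ (λ x y → 1ℤ ≤ x - y)
                 (sym (lookup-xpow-at (lastIx {m}) 1ℤ refl))
                 (sym (Vec.lookup-replicate (lastIx {m}) 0ℤ))
                 ℤ.≤-refl
  ; relation = IsDividedDifference-b≡0 {s = negLast} {f} {h} π
  }

πC-dividedDifference : ∀ {m f h} → PiBCD {m} C nothing f h → DividedDifference negLast f h
πC-dividedDifference {m} π = record
  { a = _ ; b = _ ; j = lastIx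
  ; positive = ≡.subst₂ (λ x y → 1ℤ ≤ x - y)
                 (sym (lookup-xpow-at (lastIx {m}) 1ℤ refl))
                 (sym (lookup-xpow-at (lastIx {m}) (- 1ℤ) refl))
                 (ℤ.+≤+ (s≤s z≤n))
  ; relation = π
  }

πD-dividedDifference : ∀ {m f h} → PiBCD {suc m} D nothing f h → DividedDifference tauLast f h
πD-dividedDifference {m} {f} {h} π = record
  { a = replicate _ 0ℤ ; b = _ ; j = lastIx
  ; positive = ≡.subst₂ (λ x y → 1ℤ ≤ x - y)
                 (sym (Vec.lookup-replicate (lastIx {suc m}) 0ℤ))
                 (sym (lookup-xpow-*ᴾ-at (prevIx {suc m}) lastIx (- 1ℤ) (- 1ℤ)
                                          (Finₚ.fromℕ≢inject₁ ∘ sym) refl))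
                 ℤ.≤-refl
  ; relation = IsDividedDifference-a≡0 {s = tauLast} {f} {h} π
  }

Chain-preserves : ∀ {Gen : Set} {n} {Pi : Gen → LPoly n → LPoly n → Set} (P : Pred (Exp n) 0ℓ)
  → (∀ {g f h} → Pi g f h → supp f ⊆ P → supp h ⊆ P)
  → ∀ {w f h} → Chain Pi w f h → supp f ⊆ P → supp h ⊆ P
Chain-preserves P preserves done           f⊆P = f⊆P
Chain-preserves P preserves (step {g} {f = f} {h} π chain) f⊆P =
  Chain-preserves P preserves chain (preserves {g} {f} {h} π f⊆P)

πA-preserves-Bounded : ∀ {m} T κ {i : Fin m} {f h} → PiA i f h
  → supp f ⊆ Bounded T κ → supp h ⊆ Bounded T κ
πA-preserves-Bounded T κ {i} {f} {h} π =
  π-preserves-Bounded {T = T} {κ} (swapAt-isReflection i) (πA-dividedDifference {f = f} {h} π)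

πBCD-preserves-Bounded : ∀ {m t} T κ → (∀ x → T x → T (- x)) → (t ≡ D → 1 ℕ.≤ m)
  → ∀ {g f h} → PiBCD {m} t g f h → supp f ⊆ Bounded T κ → supp h ⊆ Bounded T κ
πBCD-preserves-Bounded T κ T-neg _ {just i} {f} {h} π = πA-preserves-Bounded T κ {f = f} {h} π
πBCD-preserves-Bounded {t = B} T κ T-neg _ {nothing} {f} {h} π =
  π-preserves-Bounded {T = T} {κ} (negLast-isReflection T-neg)
                      (πB-dividedDifference {f = f} {h} π)
πBCD-preserves-Bounded {t = C} T κ T-neg _ {nothing} {f} {h} π =
  π-preserves-Bounded {T = T} {κ} (negLast-isReflection T-neg)
                      (πC-dividedDifference {f = f} {h} π)
πBCD-preserves-Bounded {zero} {D} T κ T-neg n≥2 {nothing} π with n≥2 refl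
... | ()
πBCD-preserves-Bounded {suc m} {D} T κ T-neg _ {nothing} {f} {h} π =
  π-preserves-Bounded {T = T} {κ} (tauLast-isReflection T-neg)
                      (πD-dividedDifference {m} {f} {h} π)

ChainA-preserves-Bounded : ∀ {m} T κ {w} {f h : LPoly (suc m)} → Chain PiA w f h
  → supp f ⊆ Bounded T κ → supp h ⊆ Bounded T κ
ChainA-preserves-Bounded T κ =
  Chain-preserves (Bounded T κ) (λ {i} {f} {h} → πA-preserves-Bounded T κ {i} {f} {h})

ChainBCD-preserves-Bounded : ∀ {m t} T κ → (∀ x → T x → T (- x)) → (t ≡ D → 1 ℕ.≤ m)
  → ∀ {w} {f h : LPoly (suc m)} → Chain (PiBCD t) w f h
  → supp f ⊆ Bounded T κ → supp h ⊆ Bounded T κ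
ChainBCD-preserves-Bounded T κ T-neg n≥2 =
  Chain-preserves (Bounded T κ) (λ {g} {f} {h} → πBCD-preserves-Bounded T κ T-neg n≥2 {g} {f} {h})

Ternary : ℤ → Set
Ternary x = ∣ x ∣ ℕ.≤ 1

NegBinary : ℤ → Set
NegBinary x = x ≡ 0ℤ ⊎ x ≡ - 1ℤ

Ternary-neg : ∀ x → Ternary x → Ternary (- x)
Ternary-neg x = ≡.subst (ℕ._≤ 1) (sym (ℤ.∣-i∣≡∣i∣ x))

NegBinary⇒Ternary : ∀ {x} → NegBinary x → Ternary x
NegBinary⇒Ternary (inj₁ refl) = z≤n
NegBinary⇒Ternary (inj₂ refl) = s≤s z≤n

norm₁-≤ : ∀ {n} {σ : Exp n} → All Ternary σ → norm₁ σ ℕ.≤ n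
norm₁-≤ []         = z≤n
norm₁-≤ (t ∷ σ∈T) = ℕ.+-mono-≤ t (norm₁-≤ σ∈T)

IsPartition-tail : ∀ {n a} {lam : Vec ℕ n} → IsPartition (a ∷ lam) → IsPartition lam
IsPartition-tail p i j i≤j = p (suc i) (suc j) (s≤s i≤j)

IsPartition-head : ∀ {n a} {lam : Vec ℕ n} → IsPartition (a ∷ lam) → All (_≤ + a) (toExp lam)
IsPartition-head p = All.map⁺ (All.map ℤ.+≤+ (All.lookup⁻ (λ j → p zero (suc j) z≤n)))

All-∷ʳ : ∀ {A : Set} {P : A → Set} {n} {xs : Vec A n} {x} → All P xs → P x → All P (xs ∷ʳ x)
All-∷ʳ []          px = px ∷ []
All-∷ʳ (py ∷ pys) px = py ∷ All-∷ʳ pys px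

All-reverse : ∀ {A : Set} {P : A → Set} {n} {xs : Vec A n} → All P xs → All P (reverse xs)
All-reverse []                          = []
All-reverse {P = P} {xs = x ∷ xs} (px ∷ pxs) =
  ≡.subst (All P) (sym (Vec.reverse-∷ x xs)) (All-∷ʳ (All-reverse pxs) px)

psum-suc-≤ : ∀ {n x} {y : Exp n} → 0ℤ ≤ x → All (_≤ x) y → ∀ k → psum (suc k) y ≤ x + psum k y
psum-suc-≤ {x = x} 0≤x [] zero    = ≡.subst (0ℤ ≤_) (sym (ℤ.+-identityʳ x)) 0≤x
psum-suc-≤ {x = x} 0≤x [] (suc k) = ≡.subst (0ℤ ≤_) (sym (ℤ.+-identityʳ x)) 0≤x
psum-suc-≤ 0≤x (y≤x ∷ _) zero     = ℤ.+-monoˡ-≤ 0ℤ y≤x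
psum-suc-≤ {x = x} {y ∷ ys} 0≤x (_ ∷ ys≤x) (suc k) =
  ℤ.≤-trans (ℤ.+-monoʳ-≤ y (psum-suc-≤ 0≤x ys≤x k)) (ℤ.≤-reflexive (i+[j+k]≡j+[i+k] y x _))

psum-≤-∷ : ∀ {n x} {y : Exp n} → 0ℤ ≤ x → All (_≤ x) y → ∀ k → psum k y ≤ psum k (x ∷ y)
psum-≤-∷ 0≤x y≤x zero    = ℤ.≤-refl
psum-≤-∷ 0≤x y≤x (suc k) = psum-suc-≤ 0≤x y≤x k

psum-∷ʳ : ∀ {n} k (y : Exp n) x → k ℕ.≤ n → psum k (y ∷ʳ x) ≡ psum k y
psum-∷ʳ zero    y       x _         = refl
psum-∷ʳ (suc k) (z ∷ y) x (s≤s k≤n) = cong (_+_ z) (psum-∷ʳ k y x k≤n)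

psum-suc-∷ʳ-≤ : ∀ {n x} {y : Exp n} k → k ℕ.≤ n → All (_≤ x) y
  → psum (suc k) (y ∷ʳ x) ≤ x + psum k y
psum-suc-∷ʳ-≤ zero    _         []          = ℤ.≤-refl
psum-suc-∷ʳ-≤ zero    _         (z≤x ∷ _)  = ℤ.+-monoˡ-≤ 0ℤ z≤x
psum-suc-∷ʳ-≤ {x = x} {z ∷ y} (suc k) (s≤s k≤n) (_ ∷ y≤x) =
  ℤ.≤-trans (ℤ.+-monoʳ-≤ z (psum-suc-∷ʳ-≤ k k≤n y≤x)) (ℤ.≤-reflexive (i+[j+k]≡j+[i+k] z x _))

Bounded-Ternary-partition : ∀ {n} (lam : Vec ℕ n) → IsPartition lam
  → toExp lam ∈ Bounded Ternary (λ k → psum k (toExp lam))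
Bounded-Ternary-partition []        _ []      []          = ℤ.≤-refl
Bounded-Ternary-partition (a ∷ lam) p (c ∷ σ) (c∈T ∷ σ∈T) =
  head-step c c∈T (Bounded-Ternary-partition lam (IsPartition-tail p) σ σ∈T)
  where
  λ′ = toExp lam
  head-step : ∀ c → Ternary c → dot σ λ′ ≤ psum (norm₁ σ) λ′
    → c * + a + dot σ λ′ ≤ psum (∣ c ∣ ℕ.+ norm₁ σ) (+ a ∷ λ′)
  head-step (+ 0) _ ih =
    ℤ.≤-trans (ℤ.≤-reflexive (ℤ.+-identityˡ _))
              (ℤ.≤-trans ih (psum-≤-∷ (ℤ.+≤+ z≤n) (IsPartition-head p) (norm₁ σ)))
  head-step (+ 1) _ ih = ℤ.+-mono-≤ (ℤ.≤-reflexive (ℤ.*-identityˡ (+ a))) ih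
  head-step ℤ.-[1+ 0 ] _ ih =
    ℤ.+-mono-≤ (≡.subst (_≤ + a) (sym (ℤ.-1*i≡-i (+ a))) ℤ.neg-≤-pos) ih
  head-step (+ suc (suc _)) (s≤s ())
  head-step ℤ.-[1+ suc _ ] (s≤s ())

Bounded-NegBinary-partition : ∀ {n} (lam : Vec ℕ n) → IsPartition lam
  → toExp lam ∈ Bounded NegBinary (λ k → - psum k (reverse (toExp lam)))
Bounded-NegBinary-partition []        _ []      []          = ℤ.≤-refl
Bounded-NegBinary-partition (a ∷ lam) p (c ∷ σ) (c∈T ∷ σ∈T) =
  ≡.subst (λ r → c * + a + dot σ λ′ ≤ - psum (∣ c ∣ ℕ.+ norm₁ σ) r)
          (sym (Vec.reverse-∷ (+ a) λ′))
          (head-step c∈T (Bounded-NegBinary-partition lam (IsPartition-tail p) σ σ∈T))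
  where
  open ℤ.≤-Reasoning
  λ′ = toExp lam
  k = norm₁ σ
  k≤n = norm₁-≤ (All.map NegBinary⇒Ternary σ∈T)
  head-step : ∀ {c} → NegBinary c → dot σ λ′ ≤ - psum k (reverse λ′)
    → c * + a + dot σ λ′ ≤ - psum (∣ c ∣ ℕ.+ k) (reverse λ′ ∷ʳ + a)
  head-step (inj₁ refl) ih = begin
    0ℤ * + a + dot σ λ′                ≡⟨ ℤ.+-identityˡ _ ⟩
    dot σ λ′                           ≤⟨ ih ⟩
    - psum k (reverse λ′)              ≡⟨ cong -_ (sym (psum-∷ʳ k (reverse λ′) (+ a) k≤n)) ⟩
    - psum k (reverse λ′ ∷ʳ + a)       ∎
  head-step (inj₂ refl) ih = begin
    - 1ℤ * + a + dot σ λ′              ≤⟨ ℤ.+-mono-≤ (ℤ.≤-reflexive (ℤ.-1*i≡-i (+ a))) ih ⟩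
    - + a + - psum k (reverse λ′)      ≡⟨ sym (ℤ.neg-distrib-+ (+ a) _) ⟩
    - (+ a + psum k (reverse λ′))
      ≤⟨ ℤ.neg-mono-≤ (psum-suc-∷ʳ-≤ k k≤n (All-reverse (IsPartition-head p))) ⟩
    - psum (suc k) (reverse λ′ ∷ʳ + a) ∎

negPrefix : ∀ {n} → ℕ → Exp n
negPrefix {zero}  _       = []
negPrefix {suc n} zero    = 0ℤ ∷ negPrefix zero
negPrefix {suc n} (suc k) = - 1ℤ ∷ negPrefix k

negPrefix-NegBinary : ∀ {n} k → All NegBinary (negPrefix {n} k)
negPrefix-NegBinary {zero}  _       = []
negPrefix-NegBinary {suc n} zero    = inj₁ refl ∷ negPrefix-NegBinary zero
negPrefix-NegBinary {suc n} (suc k) = inj₂ refl ∷ negPrefix-NegBinary k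

norm₁-negPrefix : ∀ {n} k → k ℕ.≤ n → norm₁ (negPrefix {n} k) ≡ k
norm₁-negPrefix {zero}  zero    _         = refl
norm₁-negPrefix {suc n} zero    _         = norm₁-negPrefix {n} zero z≤n
norm₁-negPrefix {suc n} (suc k) (s≤s k≤n) = cong suc (norm₁-negPrefix k k≤n)

dot-negPrefix : ∀ {n} k (u : Exp n) → k ℕ.≤ n → dot (negPrefix k) u ≡ - psum k u
dot-negPrefix zero    []      _         = refl
dot-negPrefix zero    (x ∷ u) _         = trans (ℤ.+-identityˡ _) (dot-negPrefix zero u z≤n)
dot-negPrefix (suc k) (x ∷ u) (s≤s k≤n) =
  trans (cong₂ _+_ (ℤ.-1*i≡-i x) (dot-negPrefix k u k≤n)) (sym (ℤ.neg-distrib-+ x (psum k u)))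

Bounded⇒psum : ∀ {n T κ} {u : Exp n} → u ∈ Bounded T κ → (∀ k → All T (negPrefix {n} k))
  → ∀ {k} → k ℕ.≤ n → - psum k u ≤ κ k
Bounded⇒psum {κ = κ} {u} u∈B prefix∈T {k} k≤n =
  ≡.subst₂ _≤_ (dot-negPrefix k u k≤n) (cong κ (norm₁-negPrefix k k≤n))
               (u∈B (negPrefix k) (prefix∈T k))

psum-negExp : ∀ {n} k (lam : Vec ℕ n) → psum k (negExp lam) ≡ - psum k (toExp lam)
psum-negExp zero    lam       = refl
psum-negExp (suc k) []        = refl
psum-negExp (suc k) (a ∷ lam) =
  trans (cong (_+_ (- + a)) (psum-negExp k lam)) (sym (ℤ.neg-distrib-+ (+ a) _))

Bounded-Ternary⇒≤D : ∀ {n} (lam : Vec ℕ n) {u} → u ∈ Bounded Ternary (λ k → psum k (toExp lam))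
  → negExp lam ≤D u
Bounded-Ternary⇒≤D lam {u} u∈B k _ k≤n =
  ≡.subst (_≤ psum k u) (sym (psum-negExp k lam))
    (ℤ.neg-cancel-≤ (≡.subst (- psum k u ≤_) (sym (ℤ.neg-involutive _))
      (Bounded⇒psum u∈B (All.map NegBinary⇒Ternary ∘ negPrefix-NegBinary) k≤n)))

Bounded-NegBinary⇒≤D : ∀ {n} (lam : Vec ℕ n) {u}
  → u ∈ Bounded NegBinary (λ k → - psum k (reverse (toExp lam))) → reverse (toExp lam) ≤D u
Bounded-NegBinary⇒≤D lam u∈B k _ k≤n = ℤ.neg-cancel-≤ (Bounded⇒psum u∈B negPrefix-NegBinary k≤n)

lemma9 : ((m : ℕ) (lam : Vec ℕ (suc m)) → IsPartition lam → (t : Heart) → (t ≡ D → 1 ℕ.≤ m)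
            → (w : List (Maybe (Fin m))) → Reduced (actBCD t) w
            → (h : LPoly (suc m)) → Chain (PiBCD t) w (mono (toExp lam)) h
            → (u : Exp (suc m)) → coeff h u ≢ 0ℤ → negExp lam ≤D u)
         × ((m : ℕ) (lam : Vec ℕ (suc m)) → IsPartition lam
            → (w : List (Fin m)) → Reduced actA w
            → (h : LPoly (suc m)) → Chain PiA w (mono (toExp lam)) h
            → (u : Exp (suc m)) → coeff h u ≢ 0ℤ → reverse (toExp lam) ≤D u)
lemma9 =
  (λ _ lam partition _ n≥2 _ _ _ chain _ u∈h →
     Bounded-Ternary⇒≤D lam
       (ChainBCD-preserves-Bounded Ternary (λ k → psum k (toExp lam)) Ternary-neg n≥2 chain
          (supp-mono {e = toExp lam} (Bounded-Ternary-partition lam partition)) u∈h))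
  ,
  (λ _ lam partition _ _ _ chain _ u∈h →
     Bounded-NegBinary⇒≤D lam
       (ChainA-preserves-Bounded NegBinary (λ k → - psum k (reverse (toExp lam))) chain
          (supp-mono {e = toExp lam} (Bounded-NegBinary-partition lam partition)) u∈h))
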